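{- Let $n\ge 2$ be an integer and let $g_{n-1,1},g_{n-1,2},\dots,g_{n-1,2^{n-1}}$ be the binary reflected Gray code of order $n-1$ (defined in the context). Then $$\sqrt{\omega(g_{n-1,1})}>\sqrt{\omega(g_{n-1,2})}>\cdots>\sqrt{\omega(g_{n-1,2^{n-1}-1})}>\sqrt{\omega(g_{n-1,2^{n-1}})}.$$ Equivalently, when the $2^{n-1}$ positive zeros of the Lucas–Lehmer polynomial $L_n$ are sorted in decreasing order, the binary strings coding them, in the order in which the zeros appear, form the Gray code of order $n-1$.
   Context: The Lucas–Lehmer polynomials are defined by $L_0(x)=x$ and $L_n(x)=L_{n-1}(x)^2-2$ for $n\ge 1$. Binary coding of nested radicals: for a binary string $s=s_1s_2\cdots s_m$ with $s_i\in\{0,1\}$, define $r(\text{empty string})=\sqrt2$ and recursively $r(s_1s_2\cdots s_m)=\sqrt{2+(-1)^{s_1}\,r(s_2\cdots s_m)}$. Set $\omega(s)=r(s)^2$, so that $$\omega(s_1\cdots s_m)=2\pm_1\sqrt{2\pm_2\sqrt{2\pm_3\cdots\pm_m\sqrt2}},$$ where the $i$-th sign $\pm_i$ is $+$ if $s_i=0$ and $-$ if $s_i=1$. Thus bit $0$ codes the sign $\oplus$ and bit $1$ codes the sign $\ominus$. As $s$ ranges over all binary strings of length $n-1$, the numbers $\sqrt{\omega(s)}$ are exactly the $2^{n-1}$ positive zeros of $L_n$. Gray code: the Gray code of order $1$ is the list $g_{1,1}=0,\ g_{1,2}=1$. If the Gray code of order $m-1$ is the list $g_{m-1,1},\dots,g_{m-1,2^{m-1}}$,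 then the Gray code of order $m$ is the list of $2^m$ strings $$0g_{m-1,1},\ 0g_{m-1,2},\dots,0g_{m-1,2^{m-1}},\ 1g_{m-1,2^{m-1}},\ 1g_{m-1,2^{m-1}-1},\dots,1g_{m-1,1}.$$ Here juxtaposition denotes concatenation of strings. For example, the Gray code of order $2$ is $00,01,11,10$. -}

module Defs where

open import Level using (Level; suc; _⊔_)
open import Data.Bool using (Bool; true; false)
open import Data.Nat as ℕ using (ℕ; zero; NonZero; s≤s; z≤n)
open import Data.Vec using (Vec; []; _∷_)
open import Data.List using (List; []; _∷_; _++_; map; reverse)
open import Data.Sum using (_⊎_)
open import Relation.Binary.Core using (Rel)
open import Relation.Binary.Structures using (IsStrictTotalOrder)
open import Algebra.Structures using (IsCommutativeRing)

-- An ordered commutative ring (strict total order compatible with + and *)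
-- equipped with a square-root function on nonnegative elements.
-- The real numbers ℝ with the usual √ are an instance.
record OrderedRingWithSqrt (c ℓ₁ ℓ₂ : Level) : Set (suc (c ⊔ ℓ₁ ⊔ ℓ₂)) where
  infix  4 _≈_ _<_ _≤_
  infixl 6 _+_
  infixl 7 _*_
  infix  8 -_
  field
    Carrier : Set c
    _≈_ : Rel Carrier ℓ₁
    _<_ : Rel Carrier ℓ₂
    _+_ : Carrier → Carrier → Carrier
    _*_ : Carrier → Carrier → Carrier
    -_  : Carrier → Carrier
    0#  : Carrier
    1#  : Carrier
    isCommutativeRing  : IsCommutativeRing _≈_ _+_ _*_ -_ 0# 1#
    isStrictTotalOrder : IsStrictTotalOrder _≈_ _<_
    +-monoˡ-< : ∀ {a b} c → a < b → a + c < b + c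
    *-pos     : ∀ {a b} → 0# < a → 0# < b → 0# < a * b
    0<1       : 0# < 1#

  _≤_ : Rel Carrier (ℓ₁ ⊔ ℓ₂)
  a ≤ b = a < b ⊎ a ≈ b

  field
    sqrt       : Carrier → Carrier
    sqrt-nonneg : ∀ x → 0# ≤ x → 0# ≤ sqrt x
    sqrt-square : ∀ x → 0# ≤ x → sqrt x * sqrt x ≈ x

-- Binary strings: bit 0 is `false` (sign ⊕), bit 1 is `true` (sign ⊖).
-- Binary reflected Gray code of order m (m ≥ 1), as a list of strings of length m.
gray : (m : ℕ) → .{{NonZero m}} → List (Vec Bool m)
gray (ℕ.suc zero) = (false ∷ []) ∷ (true ∷ []) ∷ []
gray (ℕ.suc (ℕ.suc k)) =
  map (false ∷_) (gray (ℕ.suc k)) ++ map (true ∷_) (reverse (gray (ℕ.suc k)))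

≥2⇒pred-nonZero : ∀ {n} → 2 ℕ.≤ n → NonZero (n ℕ.∸ 1)
≥2⇒pred-nonZero (s≤s (s≤s _)) = _

module NestedRadicals {c ℓ₁ ℓ₂} (F : OrderedRingWithSqrt c ℓ₁ ℓ₂) where
  open OrderedRingWithSqrt F

  2# : Carrier
  2# = 1# + 1#

  signed : Bool → Carrier → Carrier
  signed false x = x
  signed true  x = - x

  r : ∀ {m} → Vec Bool m → Carrier
  r []      = sqrt 2#
  r (b ∷ s) = sqrt (2# + signed b (r s))

  ω : ∀ {m} → Vec Bool m → Carrier
  ω s = r s * r s

-- Write r(b s) = √(2 ± r(s)) with 0 < r(s) < 2. Prefixing the bit 0 applies the
-- increasing map x ↦ √(2 + x) and so preserves the order of the values r(s);
-- prefixing 1 applies the decreasing map x ↦ √(2 − x) and so reverses it; and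
-- √(2 + x) > √(2 − x). Hence if the Gray code of order m lists its strings in
-- decreasing order of r, then so does its reflection 0 g₁ ⋯ 0 g_N 1 g_N ⋯ 1 g₁,
-- the order m + 1 code. Finally √ω(s) = r(s) because r(s) > 0.
module Submission where

open import Defs
open import Level using (Level)
open import Data.Nat using (zero; suc; s≤s)
open import Data.Bool using (Bool; true; false)
open import Data.Vec using (Vec; []; _∷_)
open import Data.List using (List; []; _∷_; _++_; _∷ʳ_; map; reverse; head; last)
open import Data.List.Properties using (unfold-reverse; reverse-involutive; head-map; last-map)
open import Data.List.Relation.Unary.Linked as Linked using (Linked; []; [-]; _∷_; head′)
open import Data.List.Relation.Unary.Linked.Properties using (map⁺; ++⁺)
open import Data.Maybe as Maybe using (just; nothing)
open import Data.Maybe.Relation.Binary.Connected as Connected using (Connected; just; nothing)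
open import Data.Sum using (inj₁; inj₂)
open import Data.Product using (_×_; _,_; proj₁; uncurry)
open import Data.Empty using (⊥-elim)
open import Function using (id; flip; _on_)
open import Relation.Binary.Core using (Rel)
open import Relation.Binary.Bundles using (StrictPartialOrder)
open import Relation.Binary.Structures using (IsStrictTotalOrder)
open import Relation.Binary.Definitions using (tri<; tri≈; tri>)
open import Relation.Binary.PropositionalEquality as ≡ using (_≡_; refl; cong)
open import Algebra.Bundles using (CommutativeRing)

module _ {a} {A : Set a} where

  last-∷ʳ : ∀ (xs : List A) y → last (xs ∷ʳ y) ≡ just y
  last-∷ʳ []           y = refl
  last-∷ʳ (_ ∷ [])     y = refl
  last-∷ʳ (_ ∷ x ∷ xs) y = last-∷ʳ (x ∷ xs) y

  last-reverse : ∀ (xs : List A) → last (reverse xs) ≡ head xs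
  last-reverse []       = refl
  last-reverse (x ∷ xs) = ≡.trans (cong last (unfold-reverse x xs)) (last-∷ʳ (reverse xs) x)

  head-reverse : ∀ (xs : List A) → head (reverse xs) ≡ last xs
  head-reverse xs = begin
    head (reverse xs)                 ≡⟨ last-reverse (reverse xs) ⟨
    last (reverse (reverse xs))       ≡⟨ cong last (reverse-involutive xs) ⟩
    last xs                           ∎
    where open ≡.≡-Reasoning

  module _ {ℓ} {R : Rel A ℓ} where

    reverse⁺ : ∀ {xs} → Linked R xs → Linked (flip R) (reverse xs)
    reverse⁺ []  = []
    reverse⁺ [-] = [-]
    reverse⁺ {x ∷ xs} Rxs rewrite unfold-reverse x xs =
      ++⁺ (reverse⁺ (Linked.tail Rxs)) last-x [-]
      where
      last-x : Connected (flip R) (last (reverse xs)) (just x)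
      last-x rewrite last-reverse xs = Connected.sym id (head′ Rxs)

module _ {a b ℓ} {A : Set a} {B : Set b} {R : Rel A ℓ} {f g : B → A} where

  mirror⁺ : ∀ {xs} → (∀ x → R (f x) (g x)) → Linked (R on f) xs → Linked (flip R on g) xs →
            Linked R (map f xs ++ map g (reverse xs))
  mirror⁺ {xs} Rfg Rf Rg = ++⁺ (map⁺ Rf) turn (map⁺ (reverse⁺ Rg))
    where
    connect : ∀ m → Connected R (Maybe.map f m) (Maybe.map g m)
    connect nothing  = nothing
    connect (just x) = just (Rfg x)

    turn : Connected R (last (map f xs)) (head (map g (reverse xs)))
    turn rewrite last-map f xs | head-map {f = g} (reverse xs) | head-reverse xs =
      connect (last xs)

module OrderedRingProperties {c ℓ₁ ℓ₂} (F : OrderedRingWithSqrt c ℓ₁ ℓ₂) where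

  open OrderedRingWithSqrt F
    using (_<_; _≤_; isCommutativeRing; isStrictTotalOrder; +-monoˡ-<; *-pos; 0<1;
           sqrt; sqrt-nonneg; sqrt-square)
  open NestedRadicals F using (2#)

  commutativeRing : CommutativeRing c ℓ₁
  commutativeRing = record { isCommutativeRing = isCommutativeRing }

  open CommutativeRing commutativeRing
  open import Algebra.Properties.Ring ring using (-0#≈0#; -‿involutive; [y-z]x≈yx-zx)
  open IsStrictTotalOrder isStrictTotalOrder using (compare; irrefl; asym; <-respˡ-≈)
    renaming (trans to <-trans)

  strictPartialOrder : StrictPartialOrder c ℓ₁ ℓ₂
  strictPartialOrder = record
    { isStrictPartialOrder = IsStrictTotalOrder.isStrictPartialOrder isStrictTotalOrder }

  open import Relation.Binary.Reasoning.StrictPartialOrder strictPartialOrder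

  +-monoʳ-< : ∀ a {x y} → x < y → a + x < a + y
  +-monoʳ-< a {x} {y} x<y = begin-strict
    a + x  ≈⟨ +-comm a x ⟩
    x + a  <⟨ +-monoˡ-< a x<y ⟩
    y + a  ≈⟨ +-comm y a ⟩
    a + y  ∎

  x<y⇒0<y-x : ∀ {x y} → x < y → 0# < y - x
  x<y⇒0<y-x {x} {y} x<y = begin-strict
    0#     ≈⟨ -‿inverseʳ x ⟨
    x - x  <⟨ +-monoˡ-< (- x) x<y ⟩
    y - x  ∎

  0<y-x⇒x<y : ∀ {x y} → 0# < y - x → x < y
  0<y-x⇒x<y {x} {y} 0<y-x = begin-strict
    x              ≈⟨ +-identityˡ x ⟨
    0# + x         <⟨ +-monoˡ-< x 0<y-x ⟩
    y - x + x      ≈⟨ +-assoc y (- x) x ⟩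
    y + (- x + x)  ≈⟨ +-congˡ (-‿inverseˡ x) ⟩
    y + 0#         ≈⟨ +-identityʳ y ⟩
    y              ∎

  -‿anti-< : ∀ {x y} → x < y → - y < - x
  -‿anti-< {x} {y} x<y = 0<y-x⇒x<y (begin-strict
    0#        <⟨ x<y⇒0<y-x x<y ⟩
    y - x     ≈⟨ +-comm y (- x) ⟩
    - x + y   ≈⟨ +-congˡ (-‿involutive y) ⟨
    - x - - y ∎)

  0<x⇒-x<0 : ∀ {x} → 0# < x → - x < 0#
  0<x⇒-x<0 {x} 0<x = begin-strict
    - x   <⟨ -‿anti-< 0<x ⟩
    - 0#  ≈⟨ -0#≈0# ⟩
    0#    ∎

  *-monoʳ-<-pos : ∀ {z x y} → 0# < z → x < y → x * z < y * z
  *-monoʳ-<-pos {z} {x} {y} 0<z x<y = 0<y-x⇒x<y (begin-strict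
    0#               <⟨ *-pos (x<y⇒0<y-x x<y) 0<z ⟩
    (y - x) * z      ≈⟨ [y-z]x≈yx-zx z y x ⟩
    y * z - x * z    ∎)

  square-mono-< : ∀ {x y} → 0# ≤ x → x < y → x * x < y * y
  square-mono-< {x} {y} (inj₁ 0<x) x<y = begin-strict
    x * x  <⟨ *-monoʳ-<-pos 0<x x<y ⟩
    y * x  ≈⟨ *-comm y x ⟩
    x * y  <⟨ *-monoʳ-<-pos (<-trans 0<x x<y) x<y ⟩
    y * y  ∎
  square-mono-< {x} {y} (inj₂ 0≈x) x<y = begin-strict
    x * x  ≈⟨ *-congʳ 0≈x ⟨
    0# * x ≈⟨ zeroˡ x ⟩
    0#     <⟨ *-pos 0<y 0<y ⟩
    y * y  ∎
    where
    0<y : 0# < y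
    0<y = <-respˡ-≈ (sym 0≈x) x<y

  square-injective : ∀ {x y} → 0# ≤ x → 0# ≤ y → x * x ≈ y * y → x ≈ y
  square-injective 0≤x 0≤y xx≈yy with compare _ _
  ... | tri< x<y _ _ = ⊥-elim (irrefl xx≈yy (square-mono-< 0≤x x<y))
  ... | tri≈ _ x≈y _ = x≈y
  ... | tri> _ _ y<x = ⊥-elim (irrefl (sym xx≈yy) (square-mono-< 0≤y y<x))

  sqrt-mono-< : ∀ {x y} → 0# ≤ x → 0# ≤ y → x < y → sqrt x < sqrt y
  sqrt-mono-< {x} {y} 0≤x 0≤y x<y with compare (sqrt x) (sqrt y)
  ... | tri< √x<√y _ _ = √x<√y
  ... | tri≈ _ √x≈√y _ = ⊥-elim (irrefl x≈y x<y)
    where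
    x≈y : x ≈ y
    x≈y = trans (sym (sqrt-square x 0≤x)) (trans (*-cong √x≈√y √x≈√y) (sqrt-square y 0≤y))
  ... | tri> _ _ √y<√x = ⊥-elim (asym x<y (begin-strict
    y                ≈⟨ sqrt-square y 0≤y ⟨
    sqrt y * sqrt y  <⟨ square-mono-< (sqrt-nonneg y 0≤y) √y<√x ⟩
    sqrt x * sqrt x  ≈⟨ sqrt-square x 0≤x ⟩
    x                ∎))

  sqrt-pos : ∀ {x} → 0# < x → 0# < sqrt x
  sqrt-pos {x} 0<x with sqrt-nonneg x (inj₁ 0<x)
  ... | inj₁ 0<√x = 0<√x
  ... | inj₂ 0≈√x = ⊥-elim (irrefl 0≈x 0<x)
    where
    0≈x : 0# ≈ x
    0≈x = trans (sym (zeroˡ (sqrt x)))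
                (trans (*-congʳ 0≈√x) (sqrt-square x (inj₁ 0<x)))

  sqrt-of-square : ∀ {x} → 0# < x → sqrt (x * x) ≈ x
  sqrt-of-square {x} 0<x =
    square-injective (sqrt-nonneg (x * x) 0≤xx) (inj₁ 0<x) (sqrt-square (x * x) 0≤xx)
    where 0≤xx = inj₁ (*-pos 0<x 0<x)

  0<2 : 0# < 2#
  0<2 = begin-strict
    0#       <⟨ 0<1 ⟩
    1#       ≈⟨ +-identityˡ 1# ⟨
    0# + 1#  <⟨ +-monoˡ-< 1# 0<1 ⟩
    2#       ∎

  2+2≈2*2 : 2# + 2# ≈ 2# * 2#
  2+2≈2*2 = sym (trans (distribˡ 2# 1# 1#) (+-cong (*-identityʳ 2#) (*-identityʳ 2#)))

  2<2*2 : 2# < 2# * 2#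
  2<2*2 = begin-strict
    2#       ≈⟨ +-identityʳ 2# ⟨
    2# + 0#  <⟨ +-monoʳ-< 2# 0<2 ⟩
    2# + 2#  ≈⟨ 2+2≈2*2 ⟩
    2# * 2#  ∎

  sqrt-bounds : ∀ {x} → 0# < x → x < 2# * 2# → 0# < sqrt x × sqrt x < 2#
  sqrt-bounds {x} 0<x x<4 = sqrt-pos 0<x , (begin-strict
    sqrt x          <⟨ sqrt-mono-< (inj₁ 0<x) (inj₁ (<-trans 0<2 2<2*2)) x<4 ⟩
    sqrt (2# * 2#)  ≈⟨ sqrt-of-square 0<2 ⟩
    2#              ∎)

module NestedRadicalOrder {c ℓ₁ ℓ₂} (F : OrderedRingWithSqrt c ℓ₁ ℓ₂) where

  open OrderedRingWithSqrt F using (_≈_; _<_; _≤_; _+_; _*_; -_; 0#; sqrt)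
  open NestedRadicals F
  open OrderedRingProperties F
  open CommutativeRing commutativeRing using (+-identityʳ)
  open IsStrictTotalOrder (OrderedRingWithSqrt.isStrictTotalOrder F) using () renaming (trans to <-trans)
  open import Relation.Binary.Reasoning.StrictPartialOrder strictPartialOrder

  radicand-bounds : ∀ b {x} → 0# < x × x < 2# →
                    0# < 2# + signed b x × 2# + signed b x < 2# * 2#
  radicand-bounds false {x} (0<x , x<2) = lower , upper
    where
    lower = begin-strict
      0#       <⟨ 0<2 ⟩
      2#       ≈⟨ +-identityʳ 2# ⟨
      2# + 0#  <⟨ +-monoʳ-< 2# 0<x ⟩
      2# + x   ∎
    upper = begin-strict
      2# + x   <⟨ +-monoʳ-< 2# x<2 ⟩
      2# + 2#  ≈⟨ 2+2≈2*2 ⟩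
      2# * 2#  ∎
  radicand-bounds true {x} (0<x , x<2) = x<y⇒0<y-x x<2 , (begin-strict
    2# + - x <⟨ +-monoʳ-< 2# (0<x⇒-x<0 0<x) ⟩
    2# + 0#  ≈⟨ +-identityʳ 2# ⟩
    2#       <⟨ 2<2*2 ⟩
    2# * 2#  ∎)

  r-bounds : ∀ {m} (s : Vec Bool m) → 0# < r s × r s < 2#
  r-bounds []      = sqrt-bounds 0<2 2<2*2
  r-bounds (b ∷ s) = uncurry sqrt-bounds (radicand-bounds b (r-bounds s))

  radicand-nonneg : ∀ b {m} (s : Vec Bool m) → 0# ≤ 2# + signed b (r s)
  radicand-nonneg b s = inj₁ (proj₁ (radicand-bounds b (r-bounds s)))

  -- A record rather than a synonym for r t < r s, so that s and t are inferable.
  infix 4 _≻_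
  record _≻_ {m} (s t : Vec Bool m) : Set ℓ₂ where
    constructor r-greater
    field r<r : r t < r s

  false∷-mono : ∀ {m} {s t : Vec Bool m} → s ≻ t → false ∷ s ≻ false ∷ t
  false∷-mono {s = s} {t} (r-greater rt<rs) = r-greater
    (sqrt-mono-< (radicand-nonneg false t) (radicand-nonneg false s) (+-monoʳ-< 2# rt<rs))

  true∷-anti : ∀ {m} {s t : Vec Bool m} → s ≻ t → true ∷ t ≻ true ∷ s
  true∷-anti {s = s} {t} (r-greater rt<rs) = r-greater
    (sqrt-mono-< (radicand-nonneg true s) (radicand-nonneg true t) (+-monoʳ-< 2# (-‿anti-< rt<rs)))

  false∷≻true∷ : ∀ {m} (s : Vec Bool m) → false ∷ s ≻ true ∷ s
  false∷≻true∷ s = r-greater (sqrt-mono-< (radicand-nonneg true s) (radicand-nonneg false s)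
    (+-monoʳ-< 2# (<-trans (0<x⇒-x<0 0<rs) 0<rs)))
    where 0<rs = proj₁ (r-bounds s)

  gray-decreasing : ∀ k → Linked _≻_ (gray (suc k))
  gray-decreasing zero    = false∷≻true∷ [] ∷ [-]
  gray-decreasing (suc k) =
    mirror⁺ false∷≻true∷ (Linked.map false∷-mono (gray-decreasing k))
                         (Linked.map true∷-anti (gray-decreasing k))

  sqrt-ω≈r : ∀ {m} (s : Vec Bool m) → sqrt (ω s) ≈ r s
  sqrt-ω≈r s = sqrt-of-square (proj₁ (r-bounds s))

  ≻⇒sqrt-ω-> : ∀ {m} {s t : Vec Bool m} → s ≻ t → sqrt (ω t) < sqrt (ω s)
  ≻⇒sqrt-ω-> {s = s} {t} (r-greater rt<rs) = begin-strict
    sqrt (ω t)  ≈⟨ sqrt-ω≈r t ⟩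
    r t         <⟨ rt<rs ⟩
    r s         ≈⟨ sqrt-ω≈r s ⟨
    sqrt (ω s)  ∎

-- Imported only here, where its _≤_ no longer clashes with that of OrderedRingWithSqrt.
open import Data.Nat using (ℕ; _≤_; _∸_)

theorem1 : ∀ {c ℓ₁ ℓ₂ : Level} (F : OrderedRingWithSqrt c ℓ₁ ℓ₂) (n : ℕ) (h : 2 ≤ n) →
    let open OrderedRingWithSqrt F
        open NestedRadicals F
    in Linked (λ x y → y < x)
         (map (λ s → sqrt (ω s)) (gray (n ∸ 1) {{≥2⇒pred-nonZero h}}))
theorem1 F (suc (suc k)) (s≤s (s≤s _)) =
  map⁺ (Linked.map ≻⇒sqrt-ω-> (gray-decreasing k))
  where open NestedRadicalOrder F
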